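{- For every integer $n\ge 1$, let $$\mathcal{K}_n := \{A\subset \{1,\ldots,n\} : \text{either } A=\emptyset \text{ or } (\max A - 1\in A \text{ and } \min A\ge |A|)\}.$$ Then $|\mathcal{K}_n| = F_n$ for all $n\ge 1$, where $(F_n)$ is the Fibonacci sequence defined by $F_1=F_2=1$ and $F_n=F_{n-1}+F_{n-2}$ for $n\ge 3$.
   Context: $|A|$ denotes the cardinality of a finite set $A$. -}

module Defs where

open import Data.Nat using (ℕ; zero; suc; _+_; _≤_)
open import Data.Fin using (Fin; toℕ)
open import Data.Fin.Subset using (Subset; _∈_; ∣_∣; Empty)
open import Data.Product using (Σ; _×_; ∃)
open import Data.Sum using (_⊎_)
open import Data.List using (List; length)
open import Data.List.Relation.Unary.Unique.Propositional using (Unique)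
import Data.List.Membership.Propositional as LM
open import Relation.Binary.PropositionalEquality using (_≡_)

fib : ℕ → ℕ
fib zero = 0
fib (suc zero) = 1
fib (suc (suc n)) = fib (suc n) + fib n

-- A subset A of {1,…,n} is represented as a Subset n (characteristic
-- vector); position i : Fin n stands for the integer toℕ i + 1.
val : ∀ {n} → Fin n → ℕ
val i = suc (toℕ i)

IsMax : ∀ {n} → Fin n → Subset n → Set
IsMax {n} m A = m ∈ A × (∀ (i : Fin n) → i ∈ A → val i ≤ val m)

IsMin : ∀ {n} → Fin n → Subset n → Set
IsMin {n} k A = k ∈ A × (∀ (i : Fin n) → i ∈ A → val k ≤ val i)

InK : ∀ {n} → Subset n → Set
InK {n} A =
  Empty A ⊎
  ((Σ (Fin n) λ m → IsMax m A × (Σ (Fin n) λ j → j ∈ A × val j + 1 ≡ val m))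
   × (Σ (Fin n) λ k → IsMin k A × ∣ A ∣ ≤ val k))

Enumerates : ∀ n → List (Subset n) → Set
Enumerates n L = Unique L × (∀ (A : Subset n) → (A LM.∈ L → InK A) × (InK A → A LM.∈ L))

CardK : ℕ → ℕ → Set
CardK n c = Σ (List (Subset n)) λ L → Enumerates n L × length L ≡ c

-- Every nonempty A ∈ 𝒦ₙ has min A ≥ |A| ≥ 2, so 1 ∉ A. Translating A down by one gives a set
-- of 𝒦ₙ₋₁ unless |A| = min A, and every set of 𝒦ₙ₋₁ arises this way. The sets with |A| = min A
-- correspond bijectively to 𝒦ₙ₋₂: delete min A and translate the rest down by two, {2,3}
-- corresponding to ∅. Hence |𝒦ₙ| = |𝒦ₙ₋₁| + |𝒦ₙ₋₂| for n ≥ 3, while 𝒦₁ = 𝒦₂ = {∅}.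
module Submission where

open import Defs
open import Data.Bool.Base using (Bool)
open import Data.Nat using (ℕ; zero; suc; pred; _+_; _≤_; z≤n; s≤s; s≤s⁻¹)
open import Data.Nat.Properties
  using (≤-refl; ≤-reflexive; ≤-trans; <-irrefl; m≤n⇒m≤1+n; m≤n⇒m<n∨m≡n; pred-mono-≤; suc-injective)
open import Data.Fin using (Fin; toℕ; zero; suc)
open import Data.Fin.Subset using (Subset; inside; outside; _∈_; ∣_∣; ⊥; Nonempty; Empty)
open import Data.Fin.Subset.Properties using (drop-there; drop-∷-Empty; Empty-unique; ∉⊥; ∣⊥∣≡0; ∣p∣≤∣x∷p∣)
open import Data.Vec.Base using ([]; _∷_; here; there)
open import Data.Vec.Properties using (∷-injectiveʳ)
open import Data.List.Base using (List; [_]; map; _++_; length)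
open import Data.List.Properties using (length-map; length-++)
open import Data.List.Membership.Propositional using () renaming (_∈_ to _∈ₗ_)
open import Data.List.Membership.Propositional.Properties using (∈-map⁺; ∈-map⁻; ∈-++⁺ˡ; ∈-++⁺ʳ; ∈-++⁻)
open import Data.List.Relation.Unary.Any using (here; there)
import Data.List.Relation.Unary.All as All
open import Data.List.Relation.Unary.All.Properties as All using ()
open import Data.List.Relation.Unary.AllPairs using ([]; _∷_)
open import Data.List.Relation.Unary.Unique.Propositional using (Unique)
open import Data.List.Relation.Unary.Unique.Propositional.Properties using (++⁺)
open import Data.Product using (Σ; _×_; _,_; ∃-syntax)
open import Data.Sum using (_⊎_; inj₁; inj₂)
import Data.Sum as Sum
open import Function using (_∘_)
open import Function.Bundles using (_⇔_; mk⇔; Equivalence)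
open import Relation.Nullary using (¬_; contradiction)
open import Relation.Binary.PropositionalEquality using (_≡_; refl; sym; trans; cong; cong₂; subst; module ≡-Reasoning)

open Equivalence using (to; from)

private
  variable
    n : ℕ
    k : ℕ
    x : Bool
    p : Subset n

unique-map⁺ : ∀ {A B : Set} {f : A → B} {xs : List A} →
              (∀ {x y} → x ∈ₗ xs → y ∈ₗ xs → f x ≡ f y → x ≡ y) →
              Unique xs → Unique (map f xs)
unique-map⁺ inj [] = []
unique-map⁺ inj (x∉xs ∷ xs!) =
  All.map⁺ (All.tabulate λ y∈xs fx≡fy → All.lookup x∉xs y∈xs (inj (here refl) (there y∈xs) fx≡fy))
  ∷ unique-map⁺ (λ x∈ y∈ → inj (there x∈) (there y∈)) xs!

module _ {A : Set} where

  Enumeration : (A → Set) → List A → Set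
  Enumeration P xs = Unique xs × (∀ x → x ∈ₗ xs ⇔ P x)

  enumeration-singleton : ∀ {P : A → Set} {a} → (∀ x → x ≡ a ⇔ P x) → Enumeration P [ a ]
  enumeration-singleton ≡a⇔P =
    (All.[] ∷ []) , λ x → mk⇔ (λ { (here x≡a) → to (≡a⇔P x) x≡a }) (here ∘ from (≡a⇔P x))

  enumeration-++ : ∀ {P Q : A → Set} {xs ys} → (∀ {x} → P x → ¬ Q x) →
                   Enumeration P xs → Enumeration Q ys → Enumeration (λ x → P x ⊎ Q x) (xs ++ ys)
  enumeration-++ {xs = xs} disjoint (xs! , xs⇔P) (ys! , ys⇔Q) =
    ++⁺ xs! ys! (λ (x∈xs , x∈ys) → disjoint (to (xs⇔P _) x∈xs) (to (ys⇔Q _) x∈ys)) ,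
    λ x → mk⇔ (Sum.map (to (xs⇔P x)) (to (ys⇔Q x)) ∘ ∈-++⁻ xs)
              (Sum.[ ∈-++⁺ˡ ∘ from (xs⇔P x) , ∈-++⁺ʳ xs ∘ from (ys⇔Q x) ])

  enumeration-⇔ : ∀ {P Q : A → Set} {xs} → (∀ x → P x ⇔ Q x) → Enumeration P xs → Enumeration Q xs
  enumeration-⇔ P⇔Q (xs! , xs⇔P) =
    xs! , λ x → mk⇔ (to (P⇔Q x) ∘ to (xs⇔P x)) (from (xs⇔P x) ∘ from (P⇔Q x))

enumeration-map : ∀ {A B : Set} {P : A → Set} {Q : B → Set} {f : A → B} {xs} →
                  (∀ {x y} → P x → P y → f x ≡ f y → x ≡ y) →
                  (∀ y → (∃[ x ] P x × f x ≡ y) ⇔ Q y) →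
                  Enumeration P xs → Enumeration Q (map f xs)
enumeration-map {f = f} {xs} inj image⇔Q (xs! , xs⇔P) =
  unique-map⁺ (λ x∈ y∈ → inj (to (xs⇔P _) x∈) (to (xs⇔P _) y∈)) xs! ,
  λ y → mk⇔ (λ y∈ → let (x , x∈xs , y≡fx) = ∈-map⁻ f y∈ in
                    to (image⇔Q y) (x , to (xs⇔P x) x∈xs , sym y≡fx))
            (λ Qy → let (x , Px , fx≡y) = from (image⇔Q y) Qy in
                    subst (_∈ₗ map f xs) fx≡y (∈-map⁺ f (from (xs⇔P x) Px)))

-- For nonempty p, leadingZeros p is min p − 1 in the paper's numbering.
leadingZeros : Subset n → ℕ
leadingZeros [] = 0
leadingZeros (inside ∷ p) = 0
leadingZeros (outside ∷ p) = suc (leadingZeros p)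

-- max p − 1 ∈ p, by recursion from the top; cons x p is p translated up by one, plus 1 if x.
data TopTwoAdjacent : Subset n → Set where
  top  : Empty p → TopTwoAdjacent (inside ∷ inside ∷ p)
  cons : ∀ x → TopTwoAdjacent p → TopTwoAdjacent (x ∷ p)

IsK : Subset n → Set
IsK p = Empty p ⊎ (TopTwoAdjacent p × ∣ p ∣ ≤ suc (leadingZeros p))

-- outside ∷ p is on the boundary |A| = min A of 𝒦.
Tight : Subset n → Set
Tight p = TopTwoAdjacent p × ∣ p ∣ ≡ 2 + leadingZeros p

empty⇒∣p∣≡0 : Empty p → ∣ p ∣ ≡ 0
empty⇒∣p∣≡0 {n} e = trans (cong ∣_∣ (Empty-unique e)) (∣⊥∣≡0 n)

⊥-empty : Empty (⊥ {n})
⊥-empty (_ , i∈⊥) = ∉⊥ i∈⊥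

outside∷-empty : Empty p → Empty (outside ∷ p)
outside∷-empty e (suc i , there i∈p) = e (i , i∈p)

topTwoAdjacent-nonempty : TopTwoAdjacent p → Nonempty p
topTwoAdjacent-nonempty (top _) = zero , here
topTwoAdjacent-nonempty (cons _ t) with topTwoAdjacent-nonempty t
... | i , i∈p = suc i , there i∈p

topTwoAdjacent-2≤∣p∣ : TopTwoAdjacent p → 2 ≤ ∣ p ∣
topTwoAdjacent-2≤∣p∣ (top _) = s≤s (s≤s z≤n)
topTwoAdjacent-2≤∣p∣ {p = x ∷ p} (cons x t) = ≤-trans (topTwoAdjacent-2≤∣p∣ t) (∣p∣≤∣x∷p∣ x p)

MaxPred∈ : Subset n → Set
MaxPred∈ {n} p = Σ (Fin n) λ m → IsMax m p × (Σ (Fin n) λ j → j ∈ p × val j + 1 ≡ val m)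

isMax-cons : {m : Fin n} → IsMax m p → IsMax (suc m) (x ∷ p)
isMax-cons (m∈p , m-max) = there m∈p , λ where
  zero _ → s≤s z≤n
  (suc i) i∈ → s≤s (m-max i (drop-there i∈))

isMax-tail : {m : Fin n} → IsMax (suc m) (x ∷ p) → IsMax m p
isMax-tail (m∈ , m-max) = drop-there m∈ , λ i i∈p → s≤s⁻¹ (m-max (suc i) (there i∈p))

topTwoAdjacent⇒maxPred∈ : TopTwoAdjacent p → MaxPred∈ p
topTwoAdjacent⇒maxPred∈ (top e) = suc zero , (there here , ≤2) , zero , here , refl
  where
  ≤2 : ∀ i → i ∈ inside ∷ inside ∷ _ → val i ≤ 2
  ≤2 zero _ = s≤s z≤n
  ≤2 (suc zero) _ = ≤-refl
  ≤2 (suc (suc i)) (there (there i∈)) = contradiction (i , i∈) e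
topTwoAdjacent⇒maxPred∈ (cons x t) with topTwoAdjacent⇒maxPred∈ t
... | m , m-max , j , j∈ , j+1≡m = suc m , isMax-cons m-max , suc j , there j∈ , cong suc j+1≡m

maxPred∈⇒topTwoAdjacent : MaxPred∈ p → TopTwoAdjacent p
maxPred∈⇒topTwoAdjacent (zero , _ , zero , _ , ())
maxPred∈⇒topTwoAdjacent (zero , _ , suc _ , _ , ())
maxPred∈⇒topTwoAdjacent (suc zero , (there here , m-max) , zero , here , refl) =
  top λ (i , i∈) → 3+i≰2 (m-max (suc (suc i)) (there (there i∈)))
  where
  3+i≰2 : ∀ {i} → ¬ 3 + i ≤ 2
  3+i≰2 (s≤s (s≤s ()))
maxPred∈⇒topTwoAdjacent (suc (suc _) , _ , zero , _ , ())
maxPred∈⇒topTwoAdjacent {p = x ∷ _} (suc m , m-max , suc j , j∈ , j+1≡m) =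
  cons x (maxPred∈⇒topTwoAdjacent (m , isMax-tail m-max , j , drop-there j∈ , suc-injective j+1≡m))

leadingZeros≤ : {i : Fin n} → i ∈ p → leadingZeros p ≤ toℕ i
leadingZeros≤ here = z≤n
leadingZeros≤ {p = inside ∷ _} (there _) = z≤n
leadingZeros≤ {p = outside ∷ _} (there i∈p) = s≤s (leadingZeros≤ i∈p)

leadingZeros-∈ : Nonempty p → Σ (Fin n) λ k → k ∈ p × toℕ k ≡ leadingZeros p
leadingZeros-∈ {p = inside ∷ _} _ = zero , here , refl
leadingZeros-∈ {p = outside ∷ _} (suc i , there i∈p) with leadingZeros-∈ (i , i∈p)
... | k , k∈p , k≡ = suc k , there k∈p , cong suc k≡

leadingZeros-isMin : Nonempty p → Σ (Fin n) λ k → IsMin k p × toℕ k ≡ leadingZeros p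
leadingZeros-isMin ne with leadingZeros-∈ ne
... | k , k∈p , k≡ = k , (k∈p , λ i i∈p → s≤s (subst (_≤ toℕ i) (sym k≡) (leadingZeros≤ i∈p))) , k≡

isMin⇒≤leadingZeros : {k : Fin n} → IsMin k p → toℕ k ≤ leadingZeros p
isMin⇒≤leadingZeros (k∈p , k-min) with leadingZeros-∈ (_ , k∈p)
... | k′ , k′∈p , k′≡ = subst (_ ≤_) k′≡ (s≤s⁻¹ (k-min k′ k′∈p))

isK⇔inK : (p : Subset n) → IsK p ⇔ InK p
isK⇔inK p = mk⇔ isK⇒inK inK⇒isK
  where
  isK⇒inK : IsK p → InK p
  isK⇒inK (inj₁ e) = inj₁ e
  isK⇒inK (inj₂ (t , ∣p∣≤)) with leadingZeros-isMin (topTwoAdjacent-nonempty t)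
  ... | k , k-min , k≡ =
    inj₂ (topTwoAdjacent⇒maxPred∈ t , k , k-min , subst (λ z → ∣ p ∣ ≤ suc z) (sym k≡) ∣p∣≤)
  inK⇒isK : InK p → IsK p
  inK⇒isK (inj₁ e) = inj₁ e
  inK⇒isK (inj₂ (mp , _ , k-min , ∣p∣≤)) =
    inj₂ (maxPred∈⇒topTwoAdjacent mp , ≤-trans ∣p∣≤ (s≤s (isMin⇒≤leadingZeros k-min)))

insert : ℕ → Subset n → Subset (suc n)
insert zero p = inside ∷ p
insert (suc k) [] = inside ∷ []
insert (suc k) (x ∷ p) = x ∷ insert k p

deleteMin : Subset (suc n) → Subset n
deleteMin (inside ∷ p) = p
deleteMin (outside ∷ []) = []
deleteMin (outside ∷ y ∷ p) = outside ∷ deleteMin (y ∷ p)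

∣insert∣≡suc∣p∣ : ∀ k (p : Subset n) → ∣ insert k p ∣ ≡ suc ∣ p ∣
∣insert∣≡suc∣p∣ zero p = refl
∣insert∣≡suc∣p∣ (suc k) [] = refl
∣insert∣≡suc∣p∣ (suc k) (inside ∷ p) = cong suc (∣insert∣≡suc∣p∣ k p)
∣insert∣≡suc∣p∣ (suc k) (outside ∷ p) = ∣insert∣≡suc∣p∣ k p

leadingZeros-insert : ∀ k (p : Subset n) → k ≤ leadingZeros p → leadingZeros (insert k p) ≡ k
leadingZeros-insert zero p _ = refl
leadingZeros-insert (suc k) (outside ∷ p) (s≤s k≤) = cong suc (leadingZeros-insert k p k≤)

deleteMin-insert : ∀ k (p : Subset n) → k ≤ leadingZeros p → deleteMin (insert k p) ≡ p
deleteMin-insert zero p _ = refl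
deleteMin-insert (suc zero) (outside ∷ p) _ = refl
deleteMin-insert (suc (suc k)) (outside ∷ []) _ = refl
deleteMin-insert (suc (suc k)) (outside ∷ y ∷ p) (s≤s k≤) = cong (outside ∷_) (deleteMin-insert (suc k) (y ∷ p) k≤)

topTwoAdjacent-insert : ∀ k → k ≤ leadingZeros p → TopTwoAdjacent p → TopTwoAdjacent (insert k p)
topTwoAdjacent-insert zero _ t = cons inside t
topTwoAdjacent-insert (suc k) (s≤s k≤) (cons outside t) = cons outside (topTwoAdjacent-insert k k≤ t)

insert-deleteMin : Nonempty p → insert (leadingZeros p) (deleteMin p) ≡ p
insert-deleteMin {p = inside ∷ p} _ = refl
insert-deleteMin {p = outside ∷ y ∷ p} (suc i , there i∈p) = cong (outside ∷_) (insert-deleteMin (i , i∈p))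

∣deleteMin∣ : Nonempty p → suc ∣ deleteMin p ∣ ≡ ∣ p ∣
∣deleteMin∣ {p = inside ∷ p} _ = refl
∣deleteMin∣ {p = outside ∷ y ∷ p} (suc i , there i∈p) = ∣deleteMin∣ (i , i∈p)

leadingZeros-deleteMin : Nonempty p → leadingZeros p ≤ leadingZeros (deleteMin p)
leadingZeros-deleteMin {p = inside ∷ p} _ = z≤n
leadingZeros-deleteMin {p = outside ∷ y ∷ p} (suc i , there i∈p) = s≤s (leadingZeros-deleteMin (i , i∈p))

topTwoAdjacent-deleteMin : 3 ≤ ∣ p ∣ → TopTwoAdjacent p → TopTwoAdjacent (deleteMin p)
topTwoAdjacent-deleteMin 3≤ (top e) with s≤s (s≤s ()) ← ≤-trans 3≤ (≤-reflexive (cong (2 +_) (empty⇒∣p∣≡0 e)))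
topTwoAdjacent-deleteMin _ (cons inside t) = t
topTwoAdjacent-deleteMin {p = outside ∷ y ∷ p} 3≤ (cons outside t) = cons outside (topTwoAdjacent-deleteMin 3≤ t)

-- Inverse of contract on Tight sets: for p ∈ 𝒦 nonempty, the minimum deleted by contract sat
-- at position ∣ p ∣ − 1, which lies within the leading zeros of p.
expand : Subset (suc n) → Subset (suc (suc n))
expand p with ∣ p ∣
... | zero  = inside ∷ inside ∷ ⊥
... | suc k = insert k p

contract : Subset (suc (suc n)) → Subset (suc n)
contract (inside ∷ _) = ⊥
contract p@(outside ∷ _) = deleteMin p

expand-empty : {p : Subset (suc n)} → Empty p → expand p ≡ inside ∷ inside ∷ ⊥
expand-empty {p = p} e with ∣ p ∣ | empty⇒∣p∣≡0 e
... | zero | _ = refl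

expand-∣p∣≡suc : {p : Subset (suc n)} → ∣ p ∣ ≡ suc k → expand p ≡ insert k p
expand-∣p∣≡suc {p = p} ∣p∣≡ with ∣ p ∣ | ∣p∣≡
... | suc _ | refl = refl

expand-topTwoAdjacent : {p : Subset (suc n)} → TopTwoAdjacent p → expand p ≡ insert (pred ∣ p ∣) p
expand-topTwoAdjacent {p = p} t with ∣ p ∣ | topTwoAdjacent-2≤∣p∣ t
... | suc _ | _ = refl

insert-tight : TopTwoAdjacent p → k ≤ leadingZeros p → suc k ≡ ∣ p ∣ → Tight (insert k p)
insert-tight {p = p} {k} t k≤ sk≡∣p∣ = topTwoAdjacent-insert k k≤ t , (begin
  ∣ insert k p ∣             ≡⟨ ∣insert∣≡suc∣p∣ k p ⟩
  suc ∣ p ∣                  ≡⟨ cong suc (sym sk≡∣p∣) ⟩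
  2 + k                      ≡⟨ cong (2 +_) (sym (leadingZeros-insert k p k≤)) ⟩
  2 + leadingZeros (insert k p) ∎)
  where open ≡-Reasoning

contract-insert : 1 ≤ k → k ≤ leadingZeros p → contract (insert k p) ≡ p
contract-insert {k = suc k} {p = outside ∷ p} _ k≤ = deleteMin-insert (suc k) (outside ∷ p) k≤

expand-tight : {p : Subset (suc n)} → IsK p → Tight (expand p)
expand-tight {n} (inj₁ e) rewrite expand-empty e = top ⊥-empty , cong (2 +_) (∣⊥∣≡0 n)
expand-tight {p = p} (inj₂ (t , ∣p∣≤)) rewrite expand-topTwoAdjacent t =
  insert-tight t (pred-mono-≤ ∣p∣≤) (suc-pred-∣p∣ (topTwoAdjacent-2≤∣p∣ t))
  where
  suc-pred-∣p∣ : ∀ {m} → 2 ≤ m → suc (pred m) ≡ m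
  suc-pred-∣p∣ (s≤s _) = refl

contract-expand : {p : Subset (suc n)} → IsK p → contract (expand p) ≡ p
contract-expand (inj₁ e) rewrite expand-empty e = sym (Empty-unique e)
contract-expand (inj₂ (t , ∣p∣≤)) rewrite expand-topTwoAdjacent t =
  contract-insert (pred-mono-≤ (topTwoAdjacent-2≤∣p∣ t)) (pred-mono-≤ ∣p∣≤)

tight-inside : Tight (inside ∷ p) → p ≡ inside ∷ ⊥
tight-inside (top e , _) = cong (inside ∷_) (Empty-unique e)
tight-inside (cons _ t , ∣p∣≡1) with s≤s () ← ≤-trans (topTwoAdjacent-2≤∣p∣ t) (≤-reflexive (suc-injective ∣p∣≡1))

tight-∣deleteMin∣ : {p : Subset (suc n)} → Tight p → ∣ deleteMin p ∣ ≡ suc (leadingZeros p)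
tight-∣deleteMin∣ (t , ∣p∣≡) = suc-injective (trans (∣deleteMin∣ (topTwoAdjacent-nonempty t)) ∣p∣≡)

contract-isK : {p : Subset (suc (suc n))} → Tight p → IsK (contract p)
contract-isK {p = inside ∷ _} _ = inj₁ ⊥-empty
contract-isK {p = outside ∷ p} tight@(t , ∣p∣≡) =
  inj₂ ( topTwoAdjacent-deleteMin (subst (3 ≤_) (sym ∣p∣≡) (s≤s (s≤s (s≤s z≤n)))) t
       , ≤-trans (≤-reflexive (tight-∣deleteMin∣ tight)) (s≤s (leadingZeros-deleteMin (topTwoAdjacent-nonempty t))))

expand-contract : {p : Subset (suc (suc n))} → Tight p → expand (contract p) ≡ p
expand-contract {p = inside ∷ _} tight rewrite tight-inside tight = expand-empty ⊥-empty
expand-contract {p = outside ∷ p} tight@(t , _) = begin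
  expand (deleteMin (outside ∷ p))                              ≡⟨ expand-∣p∣≡suc (tight-∣deleteMin∣ tight) ⟩
  insert (leadingZeros (outside ∷ p)) (deleteMin (outside ∷ p)) ≡⟨ insert-deleteMin (topTwoAdjacent-nonempty t) ⟩
  outside ∷ p                                                   ∎
  where open ≡-Reasoning

isK-inside : ¬ IsK (inside ∷ p)
isK-inside (inj₁ e) = e (zero , here)
isK-inside (inj₂ (t , ∣p∣≤1)) with s≤s () ← ≤-trans (topTwoAdjacent-2≤∣p∣ t) ∣p∣≤1

isK-outside : IsK (outside ∷ p) ⇔ (IsK p ⊎ Tight p)
isK-outside = mk⇔ split join
  where
  split : IsK (outside ∷ _) → IsK _ ⊎ Tight _
  split (inj₁ e) = inj₁ (inj₁ (drop-∷-Empty e))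
  split (inj₂ (cons _ t , ∣p∣≤)) with m≤n⇒m<n∨m≡n ∣p∣≤
  ... | inj₁ (s≤s ∣p∣≤′) = inj₁ (inj₂ (t , ∣p∣≤′))
  ... | inj₂ ∣p∣≡ = inj₂ (t , ∣p∣≡)
  join : IsK _ ⊎ Tight _ → IsK (outside ∷ _)
  join (inj₁ (inj₁ e)) = inj₁ (outside∷-empty e)
  join (inj₁ (inj₂ (t , ∣p∣≤))) = inj₂ (cons outside t , m≤n⇒m≤1+n ∣p∣≤)
  join (inj₂ (t , ∣p∣≡)) = inj₂ (cons outside t , ≤-reflexive ∣p∣≡)

isK⇒¬tight : IsK p → ¬ Tight p
isK⇒¬tight (inj₁ e) (t , _) = e (topTwoAdjacent-nonempty t)
isK⇒¬tight {p = p} (inj₂ (_ , ∣p∣≤)) (_ , ∣p∣≡) = <-irrefl refl (subst (_≤ suc (leadingZeros p)) ∣p∣≡ ∣p∣≤)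

outside∷-image : (q : Subset (suc n)) → (∃[ p ] (IsK p ⊎ Tight p) × outside ∷ p ≡ q) ⇔ IsK q
outside∷-image q = mk⇔ (λ { (_ , k⊎t , refl) → from isK-outside k⊎t }) (image q)
  where
  image : (q : Subset (suc _)) → IsK q → ∃[ p ] (IsK p ⊎ Tight p) × outside ∷ p ≡ q
  image (inside ∷ _) k = contradiction k isK-inside
  image (outside ∷ p) k = p , to isK-outside k , refl

expand-image : (q : Subset (suc (suc n))) → (∃[ p ] IsK p × expand p ≡ q) ⇔ Tight q
expand-image q = mk⇔ (λ { (_ , k , refl) → expand-tight k })
                     (λ t → contract q , contract-isK t , expand-contract t)

expand-injective : {p p′ : Subset (suc n)} → IsK p → IsK p′ → expand p ≡ expand p′ → p ≡ p′
expand-injective {p = p} {p′} k k′ eq = begin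
  p                    ≡⟨ sym (contract-expand k) ⟩
  contract (expand p)  ≡⟨ cong contract eq ⟩
  contract (expand p′) ≡⟨ contract-expand k′ ⟩
  p′                   ∎
  where open ≡-Reasoning

kSets : ∀ n → List (Subset (suc n))
kSets zero = [ ⊥ ]
kSets (suc zero) = [ ⊥ ]
kSets (suc (suc n)) = map (outside ∷_) (kSets (suc n) ++ map expand (kSets n))

empty-enumeration : (∀ {p : Subset n} → IsK p → Empty p) → Enumeration IsK [ ⊥ ]
empty-enumeration isK⇒empty = enumeration-singleton λ p →
  mk⇔ (λ { refl → inj₁ ⊥-empty }) (Empty-unique ∘ isK⇒empty)

kSets-enumeration : ∀ n → Enumeration IsK (kSets n)
kSets-enumeration zero = empty-enumeration λ { (inj₁ e) → e ; (inj₂ (cons _ () , _)) }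
kSets-enumeration (suc zero) = empty-enumeration λ where
  (inj₁ e) → e
  (inj₂ (top _ , s≤s ()))
  (inj₂ (cons _ (cons _ ()) , _))
kSets-enumeration (suc (suc n)) =
  enumeration-map (λ _ _ → ∷-injectiveʳ) outside∷-image
    (enumeration-++ isK⇒¬tight (kSets-enumeration (suc n))
      (enumeration-map expand-injective expand-image (kSets-enumeration n)))

length-kSets : ∀ n → length (kSets n) ≡ fib (suc n)
length-kSets zero = refl
length-kSets (suc zero) = refl
length-kSets (suc (suc n)) = begin
  length (map (outside ∷_) (kSets (suc n) ++ map expand (kSets n)))
    ≡⟨ length-map (outside ∷_) (kSets (suc n) ++ map expand (kSets n)) ⟩
  length (kSets (suc n) ++ map expand (kSets n))
    ≡⟨ length-++ (kSets (suc n)) ⟩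
  length (kSets (suc n)) + length (map expand (kSets n))
    ≡⟨ cong₂ _+_ (length-kSets (suc n)) (trans (length-map expand (kSets n)) (length-kSets n)) ⟩
  fib (suc (suc n)) + fib (suc n) ∎
  where open ≡-Reasoning

theorem1 : ∀ (n : ℕ) → 1 ≤ n → CardK n (fib n)
theorem1 zero ()
theorem1 (suc n) _ with enumeration-⇔ isK⇔inK (kSets-enumeration n)
... | kSets! , kSets⇔InK = kSets n , (kSets! , λ p → to (kSets⇔InK p) , from (kSets⇔InK p)) , length-kSets n
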